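{- An element $x\in\mathsf{I}\mathbb{R}$ is a total real if and only if it is maximal in $\mathsf{I}\mathbb{R}$, i.e. for all $y\in\mathsf{I}\mathbb{R}$, $x\sqsubseteq y$ implies $y\sqsubseteq x$.
   Context: Work constructively; $\tilde\exists x.A$ abbreviates $\neg\forall x.\neg A$. $\mathsf{I}\mathbb{Q}=\{[p,q]\mid p,q\in\mathbb Q,\ p\le q\}$ ordered by $[p,q]\sqsubseteq[p',q']$ iff $p\le p'\le q'\le q$; for $\alpha=[\underline\alpha,\overline\alpha]$, $\ell(\alpha)=\overline\alpha-\underline\alpha$. A chain is a sequence $(x_n)$ with $x_n\sqsubseteq x_{n+1}$; $\beta\ll\gamma$ in $\mathsf{I}\mathbb{Q}$ means: for every chain $(x_n)$ in $\mathsf{I}\mathbb{Q}$ whose supremum exists and satisfies $\gamma\sqsubseteq\bigsqcup_n x_n$, there weakly exists $n$ with $\beta\sqsubseteq x_n$. $\mathsf{I}\mathbb{R}$ is the set of increasing sequences $x=(x_n)_n=([\underline x_n,\overline x_n])_n$ in $\mathsf{I}\mathbb{Q}$, preordered by $(x_n)\sqsubseteq(y_n)$ iff for all $b\in\mathsf{I}\mathbb{Q}$ and $n$, $b\ll x_n$ implies $\tilde\exists m.\,b\ll y_m$. A total real is an $x\in\mathsf{I}\mathbb{R}$ with $\forall k\in\mathbb N.\,\tilde\exists n\in\mathbb N.\,\ell(x_n)\le2^{ -k}$. -}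

module Defs where

open import Data.Nat using (ℕ; zero; suc)
open import Data.Rational using (ℚ; _≤_; _-_; _*_; ½; 1ℚ)
open import Data.Product using (Σ; _×_; _,_)
open import Relation.Nullary using (¬_)

record IQ : Set where
  constructor [_,_]⟨_⟩
  field
    lo : ℚ
    hi : ℚ
    lo≤hi : lo ≤ hi
open IQ public

_⊑_ : IQ → IQ → Set
a ⊑ b = (lo a ≤ lo b) × (lo b ≤ hi b) × (hi b ≤ hi a)

len : IQ → ℚ
len a = hi a - lo a

pow2inv : ℕ → ℚ
pow2inv zero = 1ℚ
pow2inv (suc k) = ½ * pow2inv k

∃̃ : {A : Set} → (A → Set) → Set
∃̃ {A} P = ¬ ((x : A) → ¬ P x)

IsChain : (ℕ → IQ) → Set
IsChain x = (n : ℕ) → x n ⊑ x (suc n)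

IsSup : (ℕ → IQ) → IQ → Set
IsSup x s = ((n : ℕ) → x n ⊑ s) × ((u : IQ) → ((n : ℕ) → x n ⊑ u) → s ⊑ u)

_≪_ : IQ → IQ → Set
β ≪ γ = (x : ℕ → IQ) → IsChain x → (s : IQ) → IsSup x s → γ ⊑ s →
        ∃̃ (λ n → β ⊑ x n)

record IR : Set where
  field
    seq : ℕ → IQ
    incr : IsChain seq
open IR public

_⊑ᴿ_ : IR → IR → Set
x ⊑ᴿ y = (b : IQ) (n : ℕ) → b ≪ seq x n → ∃̃ (λ m → b ≪ seq y m)

IsTotal : IR → Set
IsTotal x = (k : ℕ) → ∃̃ (λ n → len (seq x n) ≤ pow2inv k)

IsMaximal : IR → Set
IsMaximal x = (y : IR) → x ⊑ᴿ y → y ⊑ᴿ x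

-- Everything rests on two descriptions of the way-below relation of IQ.
-- An interval containing γ in its interior is way below γ (interior⇒≪:
-- the endpoints of a supremum are weakly approximated by the chain).
-- Conversely, if b ≪ γ then b weakly contains one of the widenings
-- widen γ j = [lo γ - 2⁻ʲ , hi γ + 2⁻ʲ], since these form a chain with
-- supremum γ (≪⇒⊑widen; this needs the archimedean property of ℚ).
--
-- Total ⇒ maximal: if x ⊑ᴿ y and b ≪ y n, then b ⊑ widen (y n) j; a short
-- x m, slightly widened, is way below some y m', hence meets y n, so x m
-- lies inside widen (y n) (j+1), which is way below b.
-- Maximal ⇒ total: if no x n had length ≤ 2⁻ᵏ, lowering all upper
-- endpoints by 2⁻ᵏ would give an element above x; by maximality the upper
-- endpoints of x would then weakly keep dropping by 2⁻ᵏ⁻¹ while staying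
-- above lo (x 0), contradicting the archimedean property.
module Submission where

open import Defs
open import Data.Product using (_×_; Σ; _,_; proj₁; proj₂)
open import Data.Nat as ℕ using (ℕ; zero; suc; z≤n; _⊔_)
import Data.Nat.Properties as ℕP
open import Data.Nat.Coprimality using (Coprime)
open import Data.Integer as ℤ using (+_; -[1+_]; +<+; -<+)
import Data.Integer.Properties as ℤP
import Data.Integer.Solver as ℤSolver
open import Data.Rational using (ℚ; mkℚ; _≤_; _<_; _+_; _-_; -_; ½; 0ℚ; 1ℚ; *<*; toℚᵘ)
open import Data.Rational.Properties
import Data.Rational.Unnormalised as ℚᵘ
import Data.Rational.Unnormalised.Properties as ℚᵘP
open import Data.Rational.Solver using (module +-*-Solver)
open import Data.Empty using (⊥)
open import Level using (0ℓ)
open import Effect.Monad using (RawMonad)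
open import Relation.Nullary using (¬_)
open import Relation.Nullary.Negation using (¬¬-Monad; ∃⟶¬∀¬; ∀¬⟶¬∃; ¬∃⟶∀¬)
open import Relation.Binary.PropositionalEquality using (_≡_; refl; sym; cong; subst; subst₂)

open RawMonad (¬¬-Monad {a = 0ℓ}) using (_>>=_; pure)

∃̃⇒¬¬∃ : {A : Set} {P : A → Set} → ∃̃ P → ¬ ¬ Σ A P
∃̃⇒¬¬∃ h ¬∃ = h (¬∃⟶∀¬ ¬∃)

¬¬∃⇒∃̃ : {A : Set} {P : A → Set} → ¬ ¬ Σ A P → ∃̃ P
¬¬∃⇒∃̃ m ∀¬ = m (∀¬⟶¬∃ ∀¬)

p-q≤r⇒p≤q+r : ∀ {p q r} → p - q ≤ r → p ≤ q + r
p-q≤r⇒p≤q+r {p} {q} {r} h =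
  subst₂ _≤_ (solve 2 (λ p q → (p :- q) :+ q := p) refl p q)
             (solve 2 (λ q r → r :+ q := q :+ r) refl q r) (+-monoˡ-≤ q h)
  where open +-*-Solver

p≤q+r⇒p-q≤r : ∀ {p q r} → p ≤ q + r → p - q ≤ r
p≤q+r⇒p-q≤r {p} {q} {r} h =
  subst (p - q ≤_) (solve 2 (λ q r → (q :+ r) :- q := r) refl q r) (+-monoˡ-≤ (- q) h)
  where open +-*-Solver

p+q≤r⇒q≤r-p : ∀ {p q r} → p + q ≤ r → q ≤ r - p
p+q≤r⇒q≤r-p {p} {q} {r} h =
  subst (_≤ r - p) (solve 2 (λ p q → (p :+ q) :- p := q) refl p q) (+-monoˡ-≤ (- p) h)
  where open +-*-Solver

q≤r-p⇒p≤r-q : ∀ {p q r} → q ≤ r - p → p ≤ r - q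
q≤r-p⇒p≤r-q {p} {q} {r} h =
  subst₂ _≤_ (solve 2 (λ p q → q :+ (p :- q) := p) refl p q)
             (solve 3 (λ p q r → (r :- p) :+ (p :- q) := r :- q) refl p q r) (+-monoˡ-≤ (p - q) h)
  where open +-*-Solver

p≤p+r : ∀ {p r} → 0ℚ ≤ r → p ≤ p + r
p≤p+r {p} h = subst (_≤ p + _) (+-identityʳ p) (+-monoʳ-≤ p h)

p<p+r : ∀ {p r} → 0ℚ < r → p < p + r
p<p+r {p} h = subst (_< p + _) (+-identityʳ p) (+-monoʳ-< p h)

p-r≤p : ∀ {p r} → 0ℚ ≤ r → p - r ≤ p
p-r≤p {p} h = subst (p - _ ≤_) (+-identityʳ p) (+-monoʳ-≤ p (neg-antimono-≤ h))

p-r<p : ∀ {p r} → 0ℚ < r → p - r < p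
p-r<p {p} h = subst (p - _ <_) (+-identityʳ p) (+-monoʳ-< p (neg-antimono-< h))

pow2inv-halves : ∀ k → pow2inv (suc k) + pow2inv (suc k) ≡ pow2inv k
pow2inv-halves k = solve 1 (λ p → con ½ :* p :+ con ½ :* p := p) refl (pow2inv k)
  where open +-*-Solver

pow2inv-pos : ∀ k → 0ℚ < pow2inv k
pow2inv-pos zero    = positive⁻¹ 1ℚ
pow2inv-pos (suc k) = subst (_< pow2inv (suc k)) (*-zeroʳ ½) (*-monoʳ-<-pos ½ (pow2inv-pos k))

pow2inv-nonneg : ∀ k → 0ℚ ≤ pow2inv k
pow2inv-nonneg k = <⇒≤ (pow2inv-pos k)

pow2inv-shrinks : ∀ k → pow2inv (suc k) < pow2inv k
pow2inv-shrinks k = subst (pow2inv (suc k) <_) (pow2inv-halves k) (p<p+r (pow2inv-pos (suc k)))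

infixr 7 _·_
_·_ : ℕ → ℚ → ℚ
zero  · q = 0ℚ
suc n · q = n · q + q

·-monoʳ-≤ : ∀ n {p q} → p ≤ q → n · p ≤ n · q
·-monoʳ-≤ zero    p≤q = ≤-refl
·-monoʳ-≤ (suc n) p≤q = +-mono-≤ (·-monoʳ-≤ n p≤q) p≤q

·-toℚᵘ : ∀ n a d .(c : Coprime ℤ.∣ a ∣ (suc d)) → toℚᵘ (n · mkℚ a d c) ℚᵘ.≃ ℚᵘ.mkℚᵘ (+ n ℤ.* a) d
·-toℚᵘ zero    a d c = ℚᵘ.*≡* (solve 2 (λ a s → con (+ 0) :* s := (con (+ 0) :* a) :* con (+ 1)) refl a (+ suc d))
  where open ℤSolver.+-*-Solver
·-toℚᵘ (suc n) a d c = ℚᵘP.≃-trans (toℚᵘ-homo-+ (n · q) q)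
  (ℚᵘP.≃-trans (ℚᵘP.+-congˡ (toℚᵘ q) (·-toℚᵘ n a d c))
    (ℚᵘ.*≡* (solve 3 (λ n a s → ((n :* a) :* s :+ a :* s) :* s := ((con (+ 1) :+ n) :* a) :* (s :* s))
                     refl (+ n) a (+ suc d))))
  where
  open ℤSolver.+-*-Solver
  q : ℚ
  q = mkℚ a d c

-- The archimedean property of ℚ.  Writing η = (1+a)/(1+e): a negative D is
-- below 1 · η, and D = m/(1+f) is below N · η for N = 1 + m(1+e).
archimedean : ∀ η → 0ℚ < η → ∀ D → Σ ℕ λ N → D < N · η
archimedean (mkℚ (+ zero) _ _) (*<* (+<+ ())) _
archimedean (mkℚ -[1+ _ ] _ _) (*<* ()) _
archimedean (mkℚ (+ suc a) e c) _ (mkℚ -[1+ m ] f _) =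
  1 , toℚᵘ-cancel-< (ℚᵘP.<-respʳ-≃ (ℚᵘP.≃-sym (·-toℚᵘ 1 (+ suc a) e c)) (ℚᵘ.*<* -<+))
archimedean (mkℚ (+ suc a) e c) _ (mkℚ (+ m) f _) =
  N , toℚᵘ-cancel-< (ℚᵘP.<-respʳ-≃ (ℚᵘP.≃-sym (·-toℚᵘ N (+ suc a) e c))
                      (ℚᵘ.*<* (subst (ℤ._< + (N ℕ.* suc a ℕ.* suc f)) (ℤP.pos-* m (suc e)) (+<+ m*e<N*a*f))))
  where
  N : ℕ
  N = suc (m ℕ.* suc e)
  m*e<N*a*f : m ℕ.* suc e ℕ.< N ℕ.* suc a ℕ.* suc f
  m*e<N*a*f = ℕP.≤-trans (ℕP.m≤m*n N (suc a)) (ℕP.m≤m*n (N ℕ.* suc a) (suc f))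

·-pow2inv : ∀ n → n · pow2inv n + pow2inv n ≤ 1ℚ
·-pow2inv zero    = ≤-reflexive (+-identityˡ 1ℚ)
·-pow2inv (suc n) = begin
  (n · h + h) + h ≡⟨ +-assoc (n · h) h h ⟩
  n · h + (h + h) ≡⟨ cong (λ t → n · h + t) (pow2inv-halves n) ⟩
  n · h + p       ≤⟨ +-monoˡ-≤ p (·-monoʳ-≤ n (<⇒≤ (pow2inv-shrinks n))) ⟩
  n · p + p       ≤⟨ ·-pow2inv n ⟩
  1ℚ              ∎
  where
  open ≤-Reasoning
  h p : ℚ
  h = pow2inv (suc n)
  p = pow2inv n

-- A rational that is below b + 2⁻ʲ for every j is below b: otherwise
-- N · (a - b) > 1 for some N, while N · (a - b) ≤ N · 2⁻ᴺ ≤ 1.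
≤-by-pow2inv : ∀ {a b} → (∀ j → a ≤ b + pow2inv j) → a ≤ b
≤-by-pow2inv {a} {b} close = ≮⇒≥ λ b<a →
  let (N , 1<N·d) = archimedean (a - b) (positive-gap b<a) 1ℚ
  in <-irrefl refl (<-≤-trans 1<N·d (begin
       N · (a - b)               ≤⟨ ·-monoʳ-≤ N (p≤q+r⇒p-q≤r (close N)) ⟩
       N · pow2inv N             ≤⟨ p≤p+r (pow2inv-nonneg N) ⟩
       N · pow2inv N + pow2inv N ≤⟨ ·-pow2inv N ⟩
       1ℚ                        ∎))
  where
  open ≤-Reasoning
  positive-gap : b < a → 0ℚ < a - b
  positive-gap b<a = subst (_< a - b) (+-inverseʳ b) (+-monoˡ-< (- b) b<a)

⊑-refl : ∀ a → a ⊑ a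
⊑-refl a = ≤-refl , lo≤hi a , ≤-refl

⊑-trans : ∀ a b c → a ⊑ b → b ⊑ c → a ⊑ c
⊑-trans _ _ _ (lo₁ , _ , hi₁) (lo₂ , valid , hi₂) = ≤-trans lo₁ lo₂ , valid , ≤-trans hi₂ hi₁

chain-mono : ∀ x → IsChain x → ∀ {i j} → i ℕ.≤ j → x i ⊑ x j
chain-mono x chain {i} i≤j = go (ℕP.≤⇒≤′ i≤j)
  where
  go : ∀ {j} → i ℕ.≤′ j → x i ⊑ x j
  go ℕ.≤′-refl               = ⊑-refl (x i)
  go (ℕ.≤′-step {n = j} i≤j) = ⊑-trans (x i) (x j) (x (suc j)) (go i≤j) (chain j)

⊑-common⇒overlap : ∀ {u v w} → u ⊑ w → v ⊑ w → lo u ≤ hi v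
⊑-common⇒overlap (lo-u≤ , w-valid , _) (_ , _ , ≤hi-v) = ≤-trans lo-u≤ (≤-trans w-valid ≤hi-v)

-- Way-below implies (weakly) below: test b ≪ γ against the constant chain γ.
≪⇒⊑ : ∀ {b γ} → b ≪ γ → ¬ ¬ (b ⊑ γ)
≪⇒⊑ {b} {γ} b≪γ = do
  (_ , b⊑γ) ← ∃̃⇒¬¬∃ (b≪γ (λ _ → γ) (λ _ → ⊑-refl γ) γ ((λ _ → ⊑-refl γ) , (λ _ ub → ub 0)) (⊑-refl γ))
  pure b⊑γ

≪-⊑-trans : ∀ {b γ δ} → b ≪ γ → γ ⊑ δ → b ≪ δ
≪-⊑-trans {γ = γ} {δ} b≪γ γ⊑δ x chain s sup δ⊑s = b≪γ x chain s sup (⊑-trans γ δ s γ⊑δ δ⊑s)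

-- The endpoints of a supremum are weakly approximated strictly by the chain:
-- otherwise [q , hi s] (resp. [lo s , q]) would be a smaller upper bound.
sup-lo-approx : ∀ {x s q} → IsSup x s → q < lo s → ¬ ¬ Σ ℕ λ n → q < lo (x n)
sup-lo-approx {x} {s} {q} (ub , least) q<lo none =
  <-irrefl refl (<-≤-trans q<lo (proj₁ (least [ q , hi s ]⟨ q≤hi ⟩ bounded)))
  where
  q≤hi : q ≤ hi s
  q≤hi = ≤-trans (<⇒≤ q<lo) (lo≤hi s)
  bounded : ∀ n → x n ⊑ [ q , hi s ]⟨ q≤hi ⟩
  bounded n = ≮⇒≥ (λ q<lo-xn → none (n , q<lo-xn)) , q≤hi , proj₂ (proj₂ (ub n))

sup-hi-approx : ∀ {x s q} → IsSup x s → hi s < q → ¬ ¬ Σ ℕ λ n → hi (x n) < q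
sup-hi-approx {x} {s} {q} (ub , least) hi<q none =
  <-irrefl refl (<-≤-trans hi<q (proj₂ (proj₂ (least [ lo s , q ]⟨ lo≤q ⟩ bounded))))
  where
  lo≤q : lo s ≤ q
  lo≤q = ≤-trans (lo≤hi s) (<⇒≤ hi<q)
  bounded : ∀ n → x n ⊑ [ lo s , q ]⟨ lo≤q ⟩
  bounded n = proj₁ (ub n) , lo≤q , ≮⇒≥ (λ hi-xn<q → none (n , hi-xn<q))

interior⇒≪ : ∀ {b γ} → lo b < lo γ → hi γ < hi b → b ≪ γ
interior⇒≪ {b} lo-b<lo-γ hi-γ<hi-b x chain s sup (γ≤s , _ , s≤γ) = ¬¬∃⇒∃̃ do
  (n , lo-b<) ← sup-lo-approx {x = x} {s} sup (<-≤-trans lo-b<lo-γ γ≤s)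
  (n′ , <hi-b) ← sup-hi-approx {x = x} {s} sup (≤-<-trans s≤γ hi-γ<hi-b)
  pure (n ⊔ n′ , ≤-trans (<⇒≤ lo-b<) (proj₁ (chain-mono x chain (ℕP.m≤m⊔n n n′)))
               , lo≤hi (x (n ⊔ n′))
               , ≤-trans (proj₂ (proj₂ (chain-mono x chain (ℕP.m≤n⊔m n n′)))) (<⇒≤ <hi-b))

widen-valid : ∀ γ j → lo γ - pow2inv j ≤ hi γ + pow2inv j
widen-valid γ j = ≤-trans (p-r≤p (pow2inv-nonneg j)) (≤-trans (lo≤hi γ) (p≤p+r (pow2inv-nonneg j)))

widen : IQ → ℕ → IQ
widen γ j = [ lo γ - pow2inv j , hi γ + pow2inv j ]⟨ widen-valid γ j ⟩

widen-chain : ∀ γ → IsChain (widen γ)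
widen-chain γ j = +-monoʳ-≤ (lo γ) (neg-antimono-≤ shrink) , widen-valid γ (suc j) , +-monoʳ-≤ (hi γ) shrink
  where
  shrink : pow2inv (suc j) ≤ pow2inv j
  shrink = <⇒≤ (pow2inv-shrinks j)

widen-sup : ∀ γ → IsSup (widen γ) γ
widen-sup γ = (λ j → p-r≤p (pow2inv-nonneg j) , lo≤hi γ , p≤p+r (pow2inv-nonneg j)) , least
  where
  least : ∀ u → (∀ j → widen γ j ⊑ u) → γ ⊑ u
  least u below = ≤-by-pow2inv (λ j → subst (lo γ ≤_) (+-comm (pow2inv j) (lo u))
                                                    (p-q≤r⇒p≤q+r (proj₁ (below j))))
                , proj₁ (proj₂ (below 0))
                , ≤-by-pow2inv (λ j → proj₂ (proj₂ (below j)))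

widen-≪ : ∀ γ j → widen γ j ≪ γ
widen-≪ γ j = interior⇒≪ {widen γ j} {γ} (p-r<p (pow2inv-pos j)) (p<p+r (pow2inv-pos j))

≪⇒⊑widen : ∀ {b} γ → b ≪ γ → ∃̃ λ j → b ⊑ widen γ j
≪⇒⊑widen γ b≪γ = b≪γ (widen γ) (widen-chain γ) γ (widen-sup γ) (⊑-refl γ)

⊑widen⇒≪ : ∀ {b} γ j → b ⊑ widen γ j → b ≪ widen γ (suc j)
⊑widen⇒≪ {b} γ j (lo-b≤ , _ , ≤hi-b) = interior⇒≪ {b} {widen γ (suc j)}
  (≤-<-trans lo-b≤ (+-monoʳ-< (lo γ) (neg-antimono-< (pow2inv-shrinks j))))
  (<-≤-trans (+-monoʳ-< (hi γ) (pow2inv-shrinks j)) ≤hi-b)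

widen-small : ∀ a γ w i → len a ≤ pow2inv (suc i) → widen a (suc i) ⊑ w → γ ⊑ w → widen γ i ⊑ a
widen-small a γ w i short a⊑w γ⊑w = lo-bound , lo≤hi a , hi-bound
  where
  open ≤-Reasoning
  open +-*-Solver
  q : ℚ
  q = pow2inv (suc i)
  hi-a≤ : hi a ≤ lo a + q
  hi-a≤ = p-q≤r⇒p≤q+r short
  lo-γ≤ : lo γ ≤ hi a + q
  lo-γ≤ = ⊑-common⇒overlap {γ} {widen a (suc i)} {w} γ⊑w a⊑w
  ≤hi-γ : lo a - q ≤ hi γ
  ≤hi-γ = ⊑-common⇒overlap {widen a (suc i)} {γ} {w} a⊑w γ⊑w
  lo-bound : lo γ - pow2inv i ≤ lo a
  lo-bound = begin
    lo γ - pow2inv i          ≡⟨ cong (λ t → lo γ - t) (sym (pow2inv-halves i)) ⟩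
    lo γ - (q + q)            ≤⟨ +-monoˡ-≤ (- (q + q)) (≤-trans lo-γ≤ (+-monoˡ-≤ q hi-a≤)) ⟩
    (lo a + q) + q - (q + q)  ≡⟨ solve 2 (λ l q → (l :+ q) :+ q :- (q :+ q) := l) refl (lo a) q ⟩
    lo a                      ∎
  hi-bound : hi a ≤ hi γ + pow2inv i
  hi-bound = begin
    hi a               ≤⟨ hi-a≤ ⟩
    lo a + q           ≡⟨ solve 2 (λ l q → l :+ q := (l :- q) :+ (q :+ q)) refl (lo a) q ⟩
    lo a - q + (q + q) ≤⟨ +-monoˡ-≤ (q + q) ≤hi-γ ⟩
    hi γ + (q + q)     ≡⟨ cong (λ t → hi γ + t) (pow2inv-halves i) ⟩
    hi γ + pow2inv i   ∎

total⇒maximal : (x : IR) → IsTotal x → IsMaximal x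
total⇒maximal x total y x⊑y b n b≪yn = ¬¬∃⇒∃̃ do
  (j , b⊑wide) ← ∃̃⇒¬¬∃ (≪⇒⊑widen {b} (seq y n) b≪yn)
  (m , short) ← ∃̃⇒¬¬∃ (total (suc (suc j)))
  let c = widen (seq x m) (suc (suc j))
  (m′ , c≪ym′) ← ∃̃⇒¬¬∃ (x⊑y c m (widen-≪ (seq x m) (suc (suc j))))
  c⊑ym′ ← ≪⇒⊑ {c} {seq y m′} c≪ym′
  let w = seq y (n ⊔ m′)
      c⊑w = ⊑-trans c (seq y m′) w c⊑ym′ (chain-mono (seq y) (incr y) (ℕP.m≤n⊔m n m′))
      yn⊑w = chain-mono (seq y) (incr y) (ℕP.m≤m⊔n n m′)
      inside = widen-small (seq x m) (seq y n) w (suc j) short c⊑w yn⊑w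
  pure (m , ≪-⊑-trans {b} {widen (seq y n) (suc j)} {seq x m}
                      (⊑widen⇒≪ {b} (seq y n) j b⊑wide) inside)

-- A sequence of rationals bounded below cannot weakly descend by a fixed
-- positive amount η at every step: after N steps it would have dropped by
-- N · η, which exceeds the total room f 0 - L for N large.
no-descent : ∀ (f : ℕ → ℚ) {L η} → 0ℚ < η → (∀ m → L ≤ f m) →
             (∀ n → ¬ ¬ Σ ℕ λ m → f m + η ≤ f n) → ⊥
no-descent f {L} {η} η>0 bounded step = iterate N λ (m , dropped) →
  <-irrefl refl (<-≤-trans room<Nη (p+q≤r⇒q≤r-p (≤-trans (+-monoˡ-≤ (N · η) (bounded m)) dropped)))
  where
  open ≤-Reasoning
  open +-*-Solver
  iterate : ∀ N → ¬ ¬ Σ ℕ λ m → f m + N · η ≤ f 0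
  iterate zero    = pure (0 , ≤-reflexive (+-identityʳ (f 0)))
  iterate (suc N) = do
    (m , p) ← iterate N
    (m′ , q) ← step m
    pure (m′ , (begin
      f m′ + (N · η + η) ≡⟨ solve 3 (λ a b c → a :+ (b :+ c) := (a :+ c) :+ b) refl (f m′) (N · η) η ⟩
      (f m′ + η) + N · η ≤⟨ +-monoˡ-≤ (N · η) q ⟩
      f m + N · η        ≤⟨ p ⟩
      f 0                ∎))
  N : ℕ
  N = proj₁ (archimedean η η>0 (f 0 - L))
  room<Nη : f 0 - L < N · η
  room<Nη = proj₂ (archimedean η η>0 (f 0 - L))

maximal⇒total : (x : IR) → IsMaximal x → IsTotal x
maximal⇒total x maximal k long =
  no-descent (λ n → hi (xs n)) (pow2inv-pos (suc k)) above-lo-x₀ descends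
  where
  open ≤-Reasoning
  open +-*-Solver
  xs : ℕ → IQ
  xs = seq x
  δ η : ℚ
  δ = pow2inv k
  η = pow2inv (suc k)
  lowered-valid : ∀ n → lo (xs n) ≤ hi (xs n) - δ
  lowered-valid n = q≤r-p⇒p≤r-q {r = hi (xs n)} (<⇒≤ (≰⇒> (long n)))
  lowered : IR
  lowered = record
    { seq  = λ n → [ lo (xs n) , hi (xs n) - δ ]⟨ lowered-valid n ⟩
    ; incr = λ n → proj₁ (incr x n) , lowered-valid (suc n) , +-monoˡ-≤ (- δ) (proj₂ (proj₂ (incr x n)))
    }
  x⊑lowered : x ⊑ᴿ lowered
  x⊑lowered b n b≪xn = ∃⟶¬∀¬ (n , ≪-⊑-trans {b} {xs n} {seq lowered n} b≪xn
                                      (≤-refl , lowered-valid n , p-r≤p (pow2inv-nonneg k)))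
  -- By maximality lowered ⊑ᴿ x, so each upper endpoint is weakly undercut by η.
  descends : ∀ n → ¬ ¬ Σ ℕ λ m → hi (xs m) + η ≤ hi (xs n)
  descends n = do
    let b = widen (seq lowered n) (suc k)
    (m , b≪xm) ← ∃̃⇒¬¬∃ (maximal lowered x⊑lowered b n (widen-≪ (seq lowered n) (suc k)))
    (_ , _ , hi-xm≤) ← ≪⇒⊑ {b} {xs m} b≪xm
    pure (m , (begin
      hi (xs m) + η                 ≤⟨ +-monoˡ-≤ η hi-xm≤ ⟩
      (hi (xs n) - δ + η) + η       ≡⟨ cong (λ t → (hi (xs n) - t + η) + η) (sym (pow2inv-halves k)) ⟩
      (hi (xs n) - (η + η) + η) + η ≡⟨ solve 2 (λ h e → (h :- (e :+ e) :+ e) :+ e := h) refl (hi (xs n)) η ⟩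
      hi (xs n)                     ∎))
  above-lo-x₀ : ∀ m → lo (xs 0) ≤ hi (xs m)
  above-lo-x₀ m = ≤-trans (proj₁ (chain-mono xs (incr x) z≤n)) (lo≤hi (xs m))

lemma6p3 : (x : IR) → (IsTotal x → IsMaximal x) × (IsMaximal x → IsTotal x)
lemma6p3 x = total⇒maximal x , maximal⇒total x
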